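{- For $i=1,2$ let $\mathfrak{M}_i$ be an $\mathscr{L}_i$-structure with domain $M_i$. Let $\theta:\mathfrak{M}_1\dashrightarrow\mathfrak{M}_2$ be a p.e. interpretation of rank $r$ and let $\rho$ be a listable presentation of $\mathfrak{M}_1$. Let $X=\rho^*(\mathrm{dom}(\theta))\subseteq\mathbb{N}^r$. Then there exists a total recursive function $f:\mathbb{N}\to\mathbb{N}^r$ with image $X$, and for any such $f$ the function $\gamma=\theta\circ\rho^{(r)}\circ f:\mathbb{N}\to M_2$ is a listable presentation of $\mathfrak{M}_2$ with the property that for every $k$ and every $S\subseteq M_2^k$, $S$ is $\gamma$-listable if and only if $\theta^*(S)$ is $\rho$-listable.
   Context: All languages contain $=$, interpreted as equality. Listable means recursively enumerable. For $\rho:A\to B$, $\rho^{(r)}:A^r\to B^r$ is the coordinatewise map and $\rho^*(S)=(\rho^{(r)})^{ -1}(S)$ for $S\subseteq B^r$ (for a partial map $\theta$ defined on $\mathrm{dom}(\theta)\subseteq M_1^r$, $\theta^*(S)\subseteq M_1^{rk}$ is the preimage under the coordinatewise map on $\mathrm{dom}(\theta)^k$). A listable presentation of an $\mathscr{L}$-structure $\mathfrak{M}$ (domain $M$) is a surjection $\rho:\mathbb{N}\to M$ with $\rho^*(s^{\mathfrak{M}})$ listable for all $s\in\mathscr{L}$ (function symbols via graphs); $X\subseteq M^r$ is $\rho$-listable if $\rho^*(X)$ is listable. A p.e. interpretation $\theta:\mathfrak{M}_1\dashrightarrow\mathfrak{M}_2$ of rank $r$ is a surjection $\theta:\mathrm{dom}(\theta)\to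 M_2$ with $\mathrm{dom}(\theta)\subseteq M_1^r$ positive existentially $\mathscr{L}_1$-definable (without parameters, using only atomic formulas, $\wedge,\vee,\exists$) and $\theta^*(s^{\mathfrak{M}_2})$ p.e. $\mathscr{L}_1$-definable for each $s\in\mathscr{L}_2$. -}

module Defs where

open import Data.Nat using (ℕ; zero; suc; _+_; _*_; _<_)
open import Data.Fin using (Fin)
open import Data.Vec using (Vec; []; _∷_; map; lookup; concat)
open import Data.Vec.Relation.Unary.All using (All; []; _∷_)
open import Data.Product using (Σ; ∃; _×_; _,_; proj₁; proj₂)
open import Data.Sum using (_⊎_)
open import Function using (_⇔_; Equivalence)
open import Relation.Binary.PropositionalEquality using (_≡_; refl)

data PR : ℕ → Set where
  zer  : ∀ {n} → PR n
  suc' : PR 1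
  proj : ∀ {n} → Fin n → PR n
  comp : ∀ {m n} → PR m → Vec (PR n) m → PR n
  prec : ∀ {n} → PR n → PR (suc (suc n)) → PR (suc n)
  mu   : ∀ {n} → PR (suc n) → PR n

mutual
  data Eval : ∀ {n} → PR n → Vec ℕ n → ℕ → Set where
    zer-ev  : ∀ {n} {xs : Vec ℕ n} → Eval zer xs 0
    suc-ev  : ∀ {x} → Eval suc' (x ∷ []) (suc x)
    proj-ev : ∀ {n} (i : Fin n) {xs : Vec ℕ n} → Eval (proj i) xs (lookup xs i)
    comp-ev : ∀ {m n} {f : PR m} {gs : Vec (PR n) m} {xs : Vec ℕ n} {ys : Vec ℕ m} {y : ℕ} →
              EvalVec gs xs ys → Eval f ys y → Eval (comp f gs) xs y
    prec-zero : ∀ {n} {f : PR n} {g : PR (suc (suc n))} {xs : Vec ℕ n} {y : ℕ} →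
                Eval f xs y → Eval (prec f g) (0 ∷ xs) y
    prec-suc  : ∀ {n} {f : PR n} {g : PR (suc (suc n))} {xs : Vec ℕ n} {x y z : ℕ} →
                Eval (prec f g) (x ∷ xs) y → Eval g (x ∷ y ∷ xs) z →
                Eval (prec f g) (suc x ∷ xs) z
    mu-ev   : ∀ {n} {f : PR (suc n)} {xs : Vec ℕ n} {y : ℕ} →
              Eval f (y ∷ xs) 0 →
              (∀ z → z < y → Σ ℕ (λ w → Eval f (z ∷ xs) (suc w))) →
              Eval (mu f) xs y

  data EvalVec : ∀ {m n} → Vec (PR n) m → Vec ℕ n → Vec ℕ m → Set where
    []  : ∀ {n} {xs : Vec ℕ n} → EvalVec [] xs []
    _∷_ : ∀ {m n} {g : PR n} {gs : Vec (PR n) m} {xs : Vec ℕ n} {y : ℕ} {ys : Vec ℕ m} →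
          Eval g xs y → EvalVec gs xs ys → EvalVec (g ∷ gs) xs (y ∷ ys)

Listable : (n : ℕ) → (Vec ℕ n → Set) → Set
Listable n S = Σ (PR n) λ c → ∀ v → S v ⇔ ∃ λ y → Eval c v y

TotalRecursive : ∀ {r} → (ℕ → Vec ℕ r) → Set
TotalRecursive {r} f =
  Σ (Vec (PR 1) r) λ cs → ∀ (n : ℕ) (i : Fin r) → Eval (lookup cs i) (n ∷ []) (lookup (f n) i)

HasImage : ∀ {A : Set} → (ℕ → A) → (A → Set) → Set
HasImage {A} f X = ∀ (a : A) → X a ⇔ ∃ λ n → f n ≡ a

Surjective : ∀ {A B : Set} → (A → B) → Set
Surjective {A} {B} f = ∀ (b : B) → ∃ λ a → f a ≡ b

record Language : Set₁ where
  field
    FunSym   : Set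
    funArity : FunSym → ℕ
    RelSym   : Set
    relArity : RelSym → ℕ

record Structure (L : Language) : Set₁ where
  open Language L
  field
    Carrier : Set
    fun     : (f : FunSym) → Vec Carrier (funArity f) → Carrier
    rel     : (R : RelSym) → Vec Carrier (relArity R) → Set

module _ {L : Language} where
  open Language L

  data Term (n : ℕ) : Set where
    var : Fin n → Term n
    app : (f : FunSym) → Vec (Term n) (funArity f) → Term n

  data PEFormula (n : ℕ) : Set where
    _≐_  : Term n → Term n → PEFormula n
    rel  : (R : RelSym) → Vec (Term n) (relArity R) → PEFormula n
    _∧'_ : PEFormula n → PEFormula n → PEFormula n
    _∨'_ : PEFormula n → PEFormula n → PEFormula n
    ∃'   : PEFormula (suc n) → PEFormula n

  module _ (M : Structure L) where
    open Structure M

    mutual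
      evalT : ∀ {n} → Term n → Vec Carrier n → Carrier
      evalT (var i)    v = lookup v i
      evalT (app f ts) v = fun f (evalTs ts v)

      evalTs : ∀ {n k} → Vec (Term n) k → Vec Carrier n → Vec Carrier k
      evalTs []       v = []
      evalTs (t ∷ ts) v = evalT t v ∷ evalTs ts v

    Sat : ∀ {n} → PEFormula n → Vec Carrier n → Set
    Sat (s ≐ t)    v = evalT s v ≡ evalT t v
    Sat (rel R ts) v = Structure.rel M R (evalTs ts v)
    Sat (φ ∧' ψ)   v = Sat φ v × Sat ψ v
    Sat (φ ∨' ψ)   v = Sat φ v ⊎ Sat ψ v
    Sat (∃' φ)     v = Σ Carrier λ m → Sat φ (m ∷ v)

    PEDefinable : ∀ {n} → (Vec Carrier n → Set) → Set
    PEDefinable {n} X = Σ (PEFormula n) λ φ → ∀ v → X v ⇔ Sat φ v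

    EqRel : Vec Carrier 2 → Set
    EqRel (x ∷ y ∷ []) = x ≡ y

    Graph : (f : FunSym) → Vec Carrier (suc (funArity f)) → Set
    Graph f (y ∷ xs) = fun f xs ≡ y

pre : ∀ {A B : Set} {k} → (A → B) → (Vec B k → Set) → Vec A k → Set
pre ρ S v = S (map ρ v)

RhoListable : ∀ {M : Set} {k} → (ℕ → M) → (Vec M k → Set) → Set
RhoListable {k = k} ρ S = Listable k (pre ρ S)

record IsListablePresentation {L : Language} (M : Structure L) (ρ : ℕ → Structure.Carrier M) : Set where
  open Language L
  field
    surjective : Surjective ρ
    eq-listable  : RhoListable ρ (EqRel M)
    rel-listable : ∀ (R : RelSym) → RhoListable ρ (Structure.rel M R)
    fun-listable : ∀ (f : FunSym) → RhoListable ρ (Graph M f)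

module _ {C₁ C₂ : Set} {r : ℕ} (dom : Vec C₁ r → Set) (θ : (v : Vec C₁ r) → .(dom v) → C₂) where

  mapDom : ∀ {k} (vs : Vec (Vec C₁ r) k) → All dom vs → Vec C₂ k
  mapDom []       []       = []
  mapDom (v ∷ vs) (d ∷ ds) = θ v d ∷ mapDom vs ds

  pullback : ∀ {k} → (Vec C₂ k → Set) → Vec C₁ (k * r) → Set
  pullback {k} S w =
    Σ (Vec (Vec C₁ r) k) λ vs → (concat vs ≡ w) × Σ (All dom vs) λ ds → S (mapDom vs ds)

record PEInterpretation {L₁ L₂ : Language} (M₁ : Structure L₁) (M₂ : Structure L₂) (r : ℕ) : Set₁ where
  open Structure M₁ renaming (Carrier to C₁)
  open Structure M₂ renaming (Carrier to C₂)
  field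
    dom  : Vec C₁ r → Set
    θ    : (v : Vec C₁ r) → .(dom v) → C₂
    surj : ∀ (m : C₂) → Σ (Vec C₁ r) λ v → Σ (dom v) λ d → θ v d ≡ m
    dom-pe : PEDefinable M₁ dom
    eq-pe  : PEDefinable M₁ (pullback dom θ (EqRel M₂))
    rel-pe : ∀ (R : Language.RelSym L₂) → PEDefinable M₁ (pullback dom θ (Structure.rel M₂ R))
    fun-pe : ∀ (f : Language.FunSym L₂) → PEDefinable M₁ (pullback dom θ (Graph M₂ f))

  θ* : ∀ {k} → (Vec C₂ k → Set) → Vec C₁ (k * r) → Set
  θ* = pullback dom θ

domPre : ∀ {L₁ L₂} {M₁ : Structure L₁} {M₂ : Structure L₂} {r} →
         PEInterpretation M₁ M₂ r → (ℕ → Structure.Carrier M₁) → Vec ℕ r → Set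
domPre Θ ρ = pre ρ (PEInterpretation.dom Θ)

gamma : ∀ {L₁ L₂} {M₁ : Structure L₁} {M₂ : Structure L₂} {r} →
        (Θ : PEInterpretation M₁ M₂ r) (ρ : ℕ → Structure.Carrier M₁) (f : ℕ → Vec ℕ r) →
        HasImage f (domPre Θ ρ) → ℕ → Structure.Carrier M₂
gamma Θ ρ f img n =
  PEInterpretation.θ Θ (map ρ (f n)) (Equivalence.from (img (f n)) (n , refl))

-- A partial recursive function halts exactly when its evaluation with every μ-search cut off
-- at some bound s succeeds, and that bounded evaluation is total recursive in s. Hence the
-- listable subsets of ℕⁿ are the Σ₁ sets {v | ∃ s. T (s ∷ v) > 0} with T recursive, which are
-- closed under ∧, ∨, ∃ and recursive substitution; so under a listable presentation ρ every
-- p.e. definable set has a Σ₁ preimage. In particular X = ρ*(dom θ) is a nonempty Σ₁ set, and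
-- reading n as a pair (s, a) enumerates it. For γ = θ ∘ ρ ∘ f, the set γ*(S) is the preimage of
-- ρ*(θ* S) under (n₁,…,n_k) ↦ f n₁ ⋯ f n_k; conversely w ∈ ρ*(θ* S) iff some ns ∈ γ*(S) has
-- θ (ρ wᵢ) = γ nᵢ blockwise, a Σ₁ condition because θ*(=) is p.e. definable.

module Submission where

open import Defs
open import Data.Nat using (ℕ; zero; suc; _+_; _*_; _∸_; _<_; _≤_; z≤n; s≤s; z<s; pred; _⊔_)
open import Data.Nat.Properties
open import Data.Fin using (Fin; zero; suc; _↑ˡ_; _↑ʳ_)
open import Data.Vec using (Vec; []; _∷_; map; lookup; concat; _++_; tabulate; take; drop; tail)
open import Data.Vec.Properties
  using (∷-injective; ++-injective; map-++; map-∘; map-id; lookup-map; lookup-++ˡ; lookup-++ʳ;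
         tabulate∘lookup; tabulate-cong; take-map; drop-map; take++drop≡id)
open import Data.Vec.Relation.Unary.All using (All; []; _∷_)
open import Data.Product using (Σ; ∃; _×_; _,_; proj₁; proj₂)
open import Data.Sum using (_⊎_; inj₁; inj₂)
open import Data.Empty using (⊥-elim)
open import Data.Unit using (⊤; tt)
open import Relation.Binary using (tri<; tri≈; tri>)
open import Relation.Binary.PropositionalEquality
open import Function using (_⇔_; Equivalence; mk⇔)

open Equivalence

mutual
  Eval-deterministic : ∀ {n} {c : PR n} {v y y′} → Eval c v y → Eval c v y′ → y ≡ y′
  Eval-deterministic zer-ev           zer-ev             = refl
  Eval-deterministic suc-ev           suc-ev             = refl
  Eval-deterministic (proj-ev i)      (proj-ev .i)       = refl
  Eval-deterministic (comp-ev es e)   (comp-ev es′ e′)   with EvalVec-deterministic es es′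
  ... | refl = Eval-deterministic e e′
  Eval-deterministic (prec-zero e)    (prec-zero e′)     = Eval-deterministic e e′
  Eval-deterministic (prec-suc e₁ e₂) (prec-suc e₁′ e₂′) with Eval-deterministic e₁ e₁′
  ... | refl = Eval-deterministic e₂ e₂′
  Eval-deterministic (mu-ev {y = y} e h) (mu-ev {y = y′} e′ h′) with <-cmp y y′
  ... | tri< y<y′ _ _ = ⊥-elim (0≢1+n (Eval-deterministic e (proj₂ (h′ y y<y′))))
  ... | tri≈ _ refl _ = refl
  ... | tri> _ _ y′<y = ⊥-elim (0≢1+n (Eval-deterministic e′ (proj₂ (h y′ y′<y))))

  EvalVec-deterministic : ∀ {m n} {cs : Vec (PR n) m} {v ys ys′} →
                          EvalVec cs v ys → EvalVec cs v ys′ → ys ≡ ys′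
  EvalVec-deterministic []       []         = refl
  EvalVec-deterministic (e ∷ es) (e′ ∷ es′) =
    cong₂ _∷_ (Eval-deterministic e e′) (EvalVec-deterministic es es′)

EvalVec-lookup : ∀ {m n} {cs : Vec (PR n) m} {v ys} →
                 EvalVec cs v ys → ∀ i → Eval (lookup cs i) v (lookup ys i)
EvalVec-lookup (e ∷ es) zero    = e
EvalVec-lookup (e ∷ es) (suc i) = EvalVec-lookup es i

lookup-EvalVec : ∀ {m n} (cs : Vec (PR n) m) {v} (ys : Vec ℕ m) →
                 (∀ i → Eval (lookup cs i) v (lookup ys i)) → EvalVec cs v ys
lookup-EvalVec []       []       h = []
lookup-EvalVec (c ∷ cs) (y ∷ ys) h = h zero ∷ lookup-EvalVec cs ys (λ i → h (suc i))

-- Total recursive functions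

Recursive : ∀ {n} → (Vec ℕ n → ℕ) → Set
Recursive {n} F = Σ (PR n) λ c → ∀ v → Eval c v (F v)

RecursiveVec : ∀ {n m} → (Vec ℕ n → Vec ℕ m) → Set
RecursiveVec {n} {m} G = Σ (Vec (PR n) m) λ cs → ∀ v → EvalVec cs v (G v)

Recursive-resp : ∀ {n} {F G : Vec ℕ n → ℕ} → (∀ v → F v ≡ G v) → Recursive F → Recursive G
Recursive-resp F≗G (c , c-ok) = c , λ v → subst (Eval c v) (F≗G v) (c-ok v)

RecursiveVec-resp : ∀ {n m} {F G : Vec ℕ n → Vec ℕ m} →
                    (∀ v → F v ≡ G v) → RecursiveVec F → RecursiveVec G
RecursiveVec-resp F≗G (cs , cs-ok) = cs , λ v → subst (EvalVec cs v) (F≗G v) (cs-ok v)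

uncurry₁ : (ℕ → ℕ) → Vec ℕ 1 → ℕ
uncurry₁ f (x ∷ []) = f x

uncurry₂ : (ℕ → ℕ → ℕ) → Vec ℕ 2 → ℕ
uncurry₂ f (x ∷ y ∷ []) = f x y

uncurry₃ : (ℕ → ℕ → ℕ → ℕ) → Vec ℕ 3 → ℕ
uncurry₃ f (x ∷ y ∷ z ∷ []) = f x y z

zero-recursive : ∀ {n} → Recursive {n} (λ _ → 0)
zero-recursive = zer , λ _ → zer-ev

suc-recursive : Recursive (uncurry₁ suc)
suc-recursive = suc' , λ { (x ∷ []) → suc-ev }

lookup-recursive : ∀ {n} (i : Fin n) → Recursive (λ v → lookup v i)
lookup-recursive i = proj i , λ _ → proj-ev i

[]-recursive : ∀ {n} → RecursiveVec {n} (λ _ → [])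
[]-recursive = [] , λ _ → []

∷-recursive : ∀ {n m} {F : Vec ℕ n → ℕ} {G : Vec ℕ n → Vec ℕ m} →
              Recursive F → RecursiveVec G → RecursiveVec (λ v → F v ∷ G v)
∷-recursive (c , c-ok) (cs , cs-ok) = c ∷ cs , λ v → c-ok v ∷ cs-ok v

∘-recursive : ∀ {n m} {F : Vec ℕ m → ℕ} {G : Vec ℕ n → Vec ℕ m} →
              Recursive F → RecursiveVec G → Recursive (λ v → F (G v))
∘-recursive (c , c-ok) (cs , cs-ok) = comp c cs , λ v → comp-ev (cs-ok v) (c-ok _)

component-recursive : ∀ {n m} {G : Vec ℕ n → Vec ℕ m} →
                      RecursiveVec G → ∀ i → Recursive (λ v → lookup (G v) i)
component-recursive (cs , cs-ok) i = lookup cs i , λ v → EvalVec-lookup (cs-ok v) i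

primRec-recursive : ∀ {n} {F : Vec ℕ n → ℕ} {G : Vec ℕ (2 + n) → ℕ} {H : Vec ℕ (suc n) → ℕ} →
                    Recursive F → Recursive G →
                    (∀ v → H (0 ∷ v) ≡ F v) → (∀ x v → H (suc x ∷ v) ≡ G (x ∷ H (x ∷ v) ∷ v)) →
                    Recursive H
primRec-recursive {H = H} (c , c-ok) (d , d-ok) base step = prec c d , go
  where
    go : ∀ v → Eval (prec c d) v (H v)
    go (zero  ∷ v) = subst (Eval _ _) (sym (base v)) (prec-zero (c-ok v))
    go (suc x ∷ v) = subst (Eval _ _) (sym (step x v)) (prec-suc (go (x ∷ v)) (d-ok _))

data Expr (n : ℕ) : Set where
  var  : Fin n → Expr n
  call : ∀ {m} (F : Vec ℕ m → ℕ) → Recursive F → Vec (Expr n) m → Expr n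

mutual
  ⟦_⟧ : ∀ {n} → Expr n → Vec ℕ n → ℕ
  ⟦ var i       ⟧ v = lookup v i
  ⟦ call F _ es ⟧ v = F (⟦ es ⟧* v)

  ⟦_⟧* : ∀ {n m} → Vec (Expr n) m → Vec ℕ n → Vec ℕ m
  ⟦ []     ⟧* v = []
  ⟦ e ∷ es ⟧* v = ⟦ e ⟧ v ∷ ⟦ es ⟧* v

mutual
  ⟦⟧-recursive : ∀ {n} (e : Expr n) → Recursive ⟦ e ⟧
  ⟦⟧-recursive (var i)       = lookup-recursive i
  ⟦⟧-recursive (call F p es) = ∘-recursive p (⟦⟧*-recursive es)

  ⟦⟧*-recursive : ∀ {n m} (es : Vec (Expr n) m) → RecursiveVec ⟦ es ⟧*
  ⟦⟧*-recursive []       = []-recursive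
  ⟦⟧*-recursive (e ∷ es) = ∷-recursive (⟦⟧-recursive e) (⟦⟧*-recursive es)

recursive-by : ∀ {n} {F : Vec ℕ n → ℕ} (e : Expr n) → (∀ v → ⟦ e ⟧ v ≡ F v) → Recursive F
recursive-by e e≗F = Recursive-resp e≗F (⟦⟧-recursive e)

recursiveVec-by : ∀ {n m} {F : Vec ℕ n → Vec ℕ m} (es : Vec (Expr n) m) →
                  (∀ v → ⟦ es ⟧* v ≡ F v) → RecursiveVec F
recursiveVec-by es es≗F = RecursiveVec-resp es≗F (⟦⟧*-recursive es)

⟦tabulate⟧* : ∀ {n m} (g : Fin m → Expr n) v → ⟦ tabulate g ⟧* v ≡ tabulate (λ i → ⟦ g i ⟧ v)
⟦tabulate⟧* {m = zero}  g v = refl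
⟦tabulate⟧* {m = suc m} g v = cong (⟦ g zero ⟧ v ∷_) (⟦tabulate⟧* (λ i → g (suc i)) v)

dropVars : ∀ k {n} → Vec (Expr (k + n)) n
dropVars k = tabulate (λ i → var (k ↑ʳ i))

⟦dropVars⟧ : ∀ {k n} (u : Vec ℕ k) (v : Vec ℕ n) → ⟦ dropVars k ⟧* (u ++ v) ≡ v
⟦dropVars⟧ {k} u v = begin
  ⟦ dropVars k ⟧* (u ++ v)                  ≡⟨ ⟦tabulate⟧* _ (u ++ v) ⟩
  tabulate (λ i → lookup (u ++ v) (k ↑ʳ i)) ≡⟨ tabulate-cong (lookup-++ʳ u v) ⟩
  tabulate (lookup v)                       ≡⟨ tabulate∘lookup v ⟩
  v                                         ∎
  where open ≡-Reasoning

vars : ∀ {n} → Vec (Expr n) n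
vars = dropVars 0

⟦vars⟧ : ∀ {n} (v : Vec ℕ n) → ⟦ vars ⟧* v ≡ v
⟦vars⟧ = ⟦dropVars⟧ []

callVec : ∀ {k n m} {G : Vec ℕ n → Vec ℕ m} → RecursiveVec G → Vec (Expr k) n → Vec (Expr k) m
callVec {G = G} p es = tabulate (λ i → call (λ v → lookup (G v) i) (component-recursive p i) es)

⟦callVec⟧ : ∀ {k n m} {G : Vec ℕ n → Vec ℕ m} (p : RecursiveVec G) (es : Vec (Expr k) n) v →
            ⟦ callVec p es ⟧* v ≡ G (⟦ es ⟧* v)
⟦callVec⟧ {G = G} p es v = trans (⟦tabulate⟧* _ v) (tabulate∘lookup (G (⟦ es ⟧* v)))

#0 : ∀ {n} → Expr (1 + n)
#0 = var zero

#1 : ∀ {n} → Expr (2 + n)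
#1 = var (suc zero)

#2 : ∀ {n} → Expr (3 + n)
#2 = var (suc (suc zero))

constₑ : ∀ {n} → ℕ → Expr n
constₑ zero    = call (λ _ → 0) zero-recursive []
constₑ (suc k) = call (uncurry₁ suc) suc-recursive (constₑ k ∷ [])

⟦constₑ⟧ : ∀ {n} k (v : Vec ℕ n) → ⟦ constₑ k ⟧ v ≡ k
⟦constₑ⟧ zero    v = refl
⟦constₑ⟧ (suc k) v = cong suc (⟦constₑ⟧ k v)

sucₑ : ∀ {n} → Expr n → Expr n
sucₑ a = call (uncurry₁ suc) suc-recursive (a ∷ [])

ifZero : ∀ {A : Set} → ℕ → A → A → A
ifZero zero    x y = x
ifZero (suc _) x y = y

+-recursive : Recursive (uncurry₂ _+_)
+-recursive = primRec-recursive (lookup-recursive zero) (⟦⟧-recursive (sucₑ #1))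
  (λ { (y ∷ []) → refl }) (λ { x (y ∷ []) → refl })

infixl 6 _+ₑ_ _∸ₑ_
infixl 7 _*ₑ_

_+ₑ_ : ∀ {n} → Expr n → Expr n → Expr n
a +ₑ b = call (uncurry₂ _+_) +-recursive (a ∷ b ∷ [])

*-recursive : Recursive (uncurry₂ _*_)
*-recursive = primRec-recursive zero-recursive (⟦⟧-recursive (#2 +ₑ #1))
  (λ { (y ∷ []) → refl }) (λ { x (y ∷ []) → refl })

_*ₑ_ : ∀ {n} → Expr n → Expr n → Expr n
a *ₑ b = call (uncurry₂ _*_) *-recursive (a ∷ b ∷ [])

pred-recursive : Recursive (uncurry₁ pred)
pred-recursive = primRec-recursive zero-recursive (lookup-recursive zero)
  (λ { [] → refl }) (λ { x [] → refl })

predₑ : ∀ {n} → Expr n → Expr n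
predₑ a = call (uncurry₁ pred) pred-recursive (a ∷ [])

∸-recursive : Recursive (uncurry₂ _∸_)
∸-recursive = recursive-by (call flipped∸ flipped∸-recursive (#1 ∷ #0 ∷ [])) λ { (x ∷ y ∷ []) → refl }
  where
    flipped∸ : Vec ℕ 2 → ℕ
    flipped∸ (y ∷ x ∷ []) = x ∸ y
    flipped∸-recursive : Recursive flipped∸
    flipped∸-recursive = primRec-recursive (lookup-recursive zero) (⟦⟧-recursive (predₑ #1))
      (λ { (x ∷ []) → refl }) (λ { y (x ∷ []) → sym (pred[m∸n]≡m∸[1+n] x y) })

_∸ₑ_ : ∀ {n} → Expr n → Expr n → Expr n
a ∸ₑ b = call (uncurry₂ _∸_) ∸-recursive (a ∷ b ∷ [])

ifZero-recursive : Recursive (uncurry₃ ifZero)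
ifZero-recursive = primRec-recursive (lookup-recursive zero) (lookup-recursive (suc (suc (suc zero))))
  (λ { (x ∷ y ∷ []) → refl }) (λ { _ (x ∷ y ∷ []) → refl })

ifZeroₑ : ∀ {n} → Expr n → Expr n → Expr n → Expr n
ifZeroₑ a b c = call (uncurry₃ ifZero) ifZero-recursive (a ∷ b ∷ c ∷ [])

-- Bounded evaluation

allPositive : ∀ {m} → Vec ℕ m → ℕ
allPositive []       = 1
allPositive (z ∷ zs) = ifZero z 0 (allPositive zs)

whenPositive : ℕ → ℕ → ℕ
whenPositive a x = ifZero a 0 x

partialPrimRec : ∀ {n} → (Vec ℕ n → ℕ) → (Vec ℕ (2 + n) → ℕ) → ℕ → Vec ℕ n → ℕ
partialPrimRec F G zero    v = F v
partialPrimRec F G (suc x) v =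
  whenPositive (partialPrimRec F G x v) (G (x ∷ pred (partialPrimRec F G x v) ∷ v))

-- With F z = 0 meaning "cut off" and F z = 1 + y meaning "outputs y", search F b is 0 while
-- every candidate below b outputs a positive value, 2 + y once y outputs 0, and 1 if some
-- candidate was cut off first.
searchStep : ℕ → ℕ → ℕ → ℕ
searchStep state b q = ifZero state (ifZero q 1 (ifZero (pred q) (2 + b) 0)) state

search : (ℕ → ℕ) → ℕ → ℕ
search F zero    = 0
search F (suc b) = searchStep (search F b) b (F b)

-- boundedEval c (s ∷ v) is 1 + y if c outputs y on v when every μ-search only tries
-- candidates below s, and 0 otherwise.
mutual
  boundedEval : ∀ {n} → PR n → Vec ℕ (suc n) → ℕ
  boundedEval zer         (s ∷ v)      = 1
  boundedEval suc'        (s ∷ x ∷ []) = 2 + x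
  boundedEval (proj i)    (s ∷ v)      = suc (lookup v i)
  boundedEval (comp f gs) (s ∷ v)      =
    whenPositive (allPositive (boundedEvals gs (s ∷ v)))
                 (boundedEval f (s ∷ map pred (boundedEvals gs (s ∷ v))))
  boundedEval (prec f g)  (s ∷ x ∷ v)  =
    partialPrimRec (λ u → boundedEval f (s ∷ u)) (λ u → boundedEval g (s ∷ u)) x v
  boundedEval (mu f)      (s ∷ v)      = pred (search (λ b → boundedEval f (s ∷ b ∷ v)) s)

  boundedEvals : ∀ {m n} → Vec (PR n) m → Vec ℕ (suc n) → Vec ℕ m
  boundedEvals []       w = []
  boundedEvals (g ∷ gs) w = boundedEval g w ∷ boundedEvals gs w

allPositive-recursive : ∀ m → Recursive (allPositive {m})
allPositive-recursive zero    = recursive-by (constₑ 1) λ { [] → refl }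
allPositive-recursive (suc m) =
  recursive-by (ifZeroₑ #0 (constₑ 0) (call allPositive (allPositive-recursive m) (dropVars 1)))
    λ { (z ∷ zs) → cong (λ u → ifZero z 0 (allPositive u)) (⟦dropVars⟧ (z ∷ []) zs) }

⟦map-predₑ⟧ : ∀ {n m} (es : Vec (Expr n) m) v → ⟦ map predₑ es ⟧* v ≡ map pred (⟦ es ⟧* v)
⟦map-predₑ⟧ []       v = refl
⟦map-predₑ⟧ (e ∷ es) v = cong (pred (⟦ e ⟧ v) ∷_) (⟦map-predₑ⟧ es v)

boundedEval-comp-recursive : ∀ {n m} {f : PR m} {gs : Vec (PR n) m} →
                             Recursive (boundedEval f) → RecursiveVec (boundedEvals gs) →
                             Recursive (boundedEval (comp f gs))
boundedEval-comp-recursive {n} {m} {f} {gs} f-rec gs-rec =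
  recursive-by (ifZeroₑ (call allPositive (allPositive-recursive m) Z) (constₑ 0)
                        (call (boundedEval f) f-rec (#0 ∷ map predₑ Z)))
    λ { (s ∷ v) → cong₂ (λ zs zs′ → whenPositive (allPositive zs) (boundedEval f (s ∷ zs′)))
                        (⟦Z⟧ (s ∷ v)) (trans (⟦map-predₑ⟧ Z (s ∷ v)) (cong (map pred) (⟦Z⟧ (s ∷ v)))) }
  where
    Z : Vec (Expr (suc n)) m
    Z = callVec gs-rec vars
    ⟦Z⟧ : ∀ w → ⟦ Z ⟧* w ≡ boundedEvals gs w
    ⟦Z⟧ w = trans (⟦callVec⟧ gs-rec vars w) (cong (boundedEvals gs) (⟦vars⟧ w))

boundedEval-prec-recursive : ∀ {n} {f : PR n} {g : PR (2 + n)} →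
                             Recursive (boundedEval f) → Recursive (boundedEval g) →
                             Recursive (boundedEval (prec f g))
boundedEval-prec-recursive {n} {f} {g} f-rec g-rec =
  recursive-by (call K K-recursive (#1 ∷ #0 ∷ dropVars 2))
    λ { (s ∷ x ∷ v) → cong (λ u → boundedEval (prec f g) (s ∷ x ∷ u)) (⟦dropVars⟧ (s ∷ x ∷ []) v) }
  where
    K : Vec ℕ (2 + n) → ℕ
    K (x ∷ s ∷ v) = boundedEval (prec f g) (s ∷ x ∷ v)
    step : Expr (3 + n)
    step = ifZeroₑ #1 (constₑ 0) (call (boundedEval g) g-rec (#2 ∷ #0 ∷ predₑ #1 ∷ dropVars 3))
    K-recursive : Recursive K
    K-recursive = primRec-recursive f-rec (⟦⟧-recursive step)
      (λ { (s ∷ v) → refl })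
      (λ { x (s ∷ v) → cong (λ u → whenPositive (K (x ∷ s ∷ v))
                                                (boundedEval g (s ∷ x ∷ pred (K (x ∷ s ∷ v)) ∷ u)))
                            (sym (⟦dropVars⟧ (x ∷ K (x ∷ s ∷ v) ∷ s ∷ []) v)) })

boundedEval-mu-recursive : ∀ {n} {f : PR (suc n)} → Recursive (boundedEval f) → Recursive (boundedEval (mu f))
boundedEval-mu-recursive {n} {f} f-rec =
  recursive-by (predₑ (call K K-recursive (#0 ∷ #0 ∷ dropVars 1)))
    λ { (s ∷ v) → cong (λ u → pred (K (s ∷ s ∷ u))) (⟦dropVars⟧ (s ∷ []) v) }
  where
    K : Vec ℕ (2 + n) → ℕ
    K (b ∷ s ∷ v) = search (λ b → boundedEval f (s ∷ b ∷ v)) b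
    candidate : Expr (3 + n)
    candidate = call (boundedEval f) f-rec (#2 ∷ #0 ∷ dropVars 3)
    step : Expr (3 + n)
    step = ifZeroₑ #1 (ifZeroₑ candidate (constₑ 1)
                                  (ifZeroₑ (predₑ candidate) (constₑ 2 +ₑ #0) (constₑ 0)))
                      #1
    K-recursive : Recursive K
    K-recursive = primRec-recursive zero-recursive (⟦⟧-recursive step)
      (λ { (s ∷ v) → refl })
      (λ { b (s ∷ v) → cong (λ u → searchStep (K (b ∷ s ∷ v)) b (boundedEval f (s ∷ b ∷ u)))
                            (sym (⟦dropVars⟧ (b ∷ K (b ∷ s ∷ v) ∷ s ∷ []) v)) })

mutual
  boundedEval-recursive : ∀ {n} (c : PR n) → Recursive (boundedEval c)
  boundedEval-recursive zer         = recursive-by (constₑ 1) λ { (s ∷ v) → refl }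
  boundedEval-recursive suc'        = recursive-by (sucₑ (sucₑ #1)) λ { (s ∷ x ∷ []) → refl }
  boundedEval-recursive (proj i)    = recursive-by (sucₑ (var (suc i))) λ { (s ∷ v) → refl }
  boundedEval-recursive (comp f gs) =
    boundedEval-comp-recursive (boundedEval-recursive f) (boundedEvals-recursive gs)
  boundedEval-recursive (prec f g)  =
    boundedEval-prec-recursive (boundedEval-recursive f) (boundedEval-recursive g)
  boundedEval-recursive (mu f)      = boundedEval-mu-recursive (boundedEval-recursive f)

  boundedEvals-recursive : ∀ {m n} (gs : Vec (PR n) m) → RecursiveVec (boundedEvals gs)
  boundedEvals-recursive []       = []-recursive
  boundedEvals-recursive (g ∷ gs) = ∷-recursive (boundedEval-recursive g) (boundedEvals-recursive gs)

search-running : ∀ F b → search F b ≡ 0 → ∀ z → z < b → ∃ λ w → F z ≡ 2 + w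
search-running F (suc b) eq z z<b with search F b in running
search-running F (suc b) eq z z<b | zero with F b in Fb
search-running F (suc b) () z z<b       | zero | zero
search-running F (suc b) () z z<b       | zero | suc zero
search-running F (suc b) eq z (s≤s z≤b) | zero | suc (suc w) with m≤n⇒m<n∨m≡n z≤b
... | inj₁ z<b = search-running F b running z z<b
... | inj₂ refl = w , Fb
search-running F (suc b) () z z<b | suc _

search-found : ∀ F b y → search F b ≡ 2 + y → F y ≡ 1 × (∀ z → z < y → ∃ λ w → F z ≡ 2 + w)
search-found F (suc b) y eq with search F b in state
search-found F (suc b) y eq   | zero with F b in Fb
search-found F (suc b) y ()   | zero | zero
search-found F (suc b) y refl | zero | suc zero = Fb , search-running F b state
search-found F (suc b) y ()   | zero | suc (suc w)
search-found F (suc b) y refl | suc _ = search-found F b y state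

search-continues : ∀ F y → (∀ z → z < y → ∃ λ w → F z ≡ 2 + w) → ∀ b → b ≤ y → search F b ≡ 0
search-continues F y below zero    b≤y = refl
search-continues F y below (suc b) b<y
  rewrite search-continues F y below b (≤-trans (n≤1+n b) b<y) | proj₂ (below b b<y) = refl

search-finds : ∀ F y → F y ≡ 1 → (∀ z → z < y → ∃ λ w → F z ≡ 2 + w) →
               ∀ b → y < b → search F b ≡ 2 + y
search-finds F y Fy below (suc b) (s≤s y≤b) with m≤n⇒m<n∨m≡n y≤b
... | inj₂ refl rewrite search-continues F y below y ≤-refl | Fy = refl
... | inj₁ y<b  rewrite search-finds F y Fy below b y<b = refl

mutual
  boundedEval-sound : ∀ {n} (c : PR n) s v y → boundedEval c (s ∷ v) ≡ suc y → Eval c v y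
  boundedEval-sound zer      s v        _ refl = zer-ev
  boundedEval-sound suc'     s (x ∷ []) _ refl = suc-ev
  boundedEval-sound (proj i) s v        _ refl = proj-ev i
  boundedEval-sound (comp f gs) s v y eq with allPositive (boundedEvals gs (s ∷ v)) in positive
  ... | suc _ = comp-ev (boundedEvals-sound gs s v (subst (0 <_) (sym positive) z<s))
                        (boundedEval-sound f s _ y eq)
  boundedEval-sound (prec f g) s (x ∷ v) y eq = go x y eq
    where
      go : ∀ x y → boundedEval (prec f g) (s ∷ x ∷ v) ≡ suc y → Eval (prec f g) (x ∷ v) y
      go zero    y eq = prec-zero (boundedEval-sound f s v y eq)
      go (suc x) y eq with boundedEval (prec f g) (s ∷ x ∷ v) in previous
      ... | suc p = prec-suc (go x p previous) (boundedEval-sound g s _ y eq)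
  boundedEval-sound (mu f) s v y eq with search (λ b → boundedEval f (s ∷ b ∷ v)) s in found
  ... | suc (suc y′) with eq
  ... | refl with search-found _ s y found
  ... | returns0 , below = mu-ev (boundedEval-sound f s _ 0 returns0)
                                 (λ z z<y → let w , e = below z z<y in w , boundedEval-sound f s _ (suc w) e)

  boundedEvals-sound : ∀ {m n} (gs : Vec (PR n) m) s v → 0 < allPositive (boundedEvals gs (s ∷ v)) →
                       EvalVec gs v (map pred (boundedEvals gs (s ∷ v)))
  boundedEvals-sound []       s v _ = []
  boundedEvals-sound (g ∷ gs) s v positive with boundedEval g (s ∷ v) in e
  ... | suc y = boundedEval-sound g s v y e ∷ boundedEvals-sound gs s v positive

Eventually : (ℕ → Set) → Set
Eventually Q = ∃ λ s₀ → ∀ s → s₀ ≤ s → Q s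

Eventually-× : ∀ {Q R : ℕ → Set} → Eventually Q → Eventually R → Eventually (λ s → Q s × R s)
Eventually-× (a , Q≥a) (b , R≥b) =
  a ⊔ b , λ s a⊔b≤s → Q≥a s (≤-trans (m≤m⊔n a b) a⊔b≤s) , R≥b s (≤-trans (m≤n⊔m a b) a⊔b≤s)

Eventually-∀< : ∀ (Q : ℕ → ℕ → Set) y → (∀ z → z < y → Eventually (Q z)) →
                Eventually (λ s → ∀ z → z < y → Q z s)
Eventually-∀< Q zero    each = 0 , λ s _ z ()
Eventually-∀< Q (suc y) each
  with Eventually-× (Eventually-∀< Q y (λ z z<y → each z (m<n⇒m<1+n z<y))) (each y ≤-refl)
... | s₀ , later = s₀ , λ s s₀≤s z z<1+y → case (m≤n⇒m<n∨m≡n (≤-pred z<1+y)) (later s s₀≤s)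
  where
    case : ∀ {z s} → z < y ⊎ z ≡ y → (∀ z → z < y → Q z s) × Q y s → Q z s
    case (inj₁ z<y)  (below , _) = below _ z<y
    case (inj₂ refl) (_ , at-y)  = at-y

allPositive-map-suc : ∀ {m} (ys : Vec ℕ m) → allPositive (map suc ys) ≡ 1
allPositive-map-suc []       = refl
allPositive-map-suc (y ∷ ys) = allPositive-map-suc ys

map-pred∘suc : ∀ {m} (ys : Vec ℕ m) → map pred (map suc ys) ≡ ys
map-pred∘suc ys = trans (sym (map-∘ pred suc ys)) (map-id ys)

mutual
  boundedEval-complete : ∀ {n} {c : PR n} {v y} → Eval c v y →
                         Eventually (λ s → boundedEval c (s ∷ v) ≡ suc y)
  boundedEval-complete zer-ev      = 0 , λ _ _ → refl
  boundedEval-complete suc-ev      = 0 , λ _ _ → refl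
  boundedEval-complete (proj-ev i) = 0 , λ _ _ → refl
  boundedEval-complete (comp-ev {f = f} {gs = gs} {xs = xs} {ys = ys} es e)
    with Eventually-× (boundedEvals-complete es) (boundedEval-complete e)
  ... | s₀ , later = s₀ , λ s s₀≤s → let args , result = later s s₀≤s in begin
    whenPositive (allPositive (boundedEvals gs (s ∷ xs))) (boundedEval f (s ∷ map pred (boundedEvals gs (s ∷ xs))))
      ≡⟨ cong (λ zs → whenPositive (allPositive zs) (boundedEval f (s ∷ map pred zs))) args ⟩
    whenPositive (allPositive (map suc ys)) (boundedEval f (s ∷ map pred (map suc ys)))
      ≡⟨ cong₂ (λ p u → whenPositive p (boundedEval f (s ∷ u))) (allPositive-map-suc ys) (map-pred∘suc ys) ⟩
    boundedEval f (s ∷ ys)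
      ≡⟨ result ⟩
    suc _ ∎
    where open ≡-Reasoning
  boundedEval-complete (prec-zero e) = boundedEval-complete e
  boundedEval-complete (prec-suc {g = g} {xs = xs} {x = x} e₁ e₂)
    with Eventually-× (boundedEval-complete e₁) (boundedEval-complete e₂)
  ... | s₀ , later = s₀ , λ s s₀≤s → let previous , step = later s s₀≤s in
    trans (cong (λ p → whenPositive p (boundedEval g (s ∷ x ∷ pred p ∷ xs))) previous) step
  boundedEval-complete (mu-ev {f = f} {xs = xs} {y = y} e below)
    with Eventually-× (boundedEval-complete e)
           (Eventually-∀< (λ z s → ∃ λ w → boundedEval f (s ∷ z ∷ xs) ≡ 2 + w) y
                          (λ z z<y → let w , d = below z z<y ; s₀ , later = boundedEval-complete d
                                     in s₀ , λ s s₀≤s → w , later s s₀≤s))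
  ... | s₀ , later = s₀ ⊔ suc y , λ s bound≤s →
    let returns0 , continues = later s (≤-trans (m≤m⊔n s₀ (suc y)) bound≤s)
    in cong pred (search-finds _ y returns0 continues s (≤-trans (m≤n⊔m s₀ (suc y)) bound≤s))

  boundedEvals-complete : ∀ {m n} {gs : Vec (PR n) m} {v ys} → EvalVec gs v ys →
                          Eventually (λ s → boundedEvals gs (s ∷ v) ≡ map suc ys)
  boundedEvals-complete []       = 0 , λ _ _ → refl
  boundedEvals-complete (e ∷ es) with Eventually-× (boundedEval-complete e) (boundedEvals-complete es)
  ... | s₀ , later = s₀ , λ s s₀≤s → let head , rest = later s s₀≤s in cong₂ _∷_ head rest

-- Σ₁ sets

Σ₁ : (n : ℕ) → (Vec ℕ n → Set) → Set
Σ₁ n S = Σ (Vec ℕ (suc n) → ℕ) λ T → Recursive T × (∀ v → S v ⇔ ∃ λ s → 0 < T (s ∷ v))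

Σ₁-resp-⇔ : ∀ {n} {S S′ : Vec ℕ n → Set} → (∀ v → S v ⇔ S′ v) → Σ₁ n S → Σ₁ n S′
Σ₁-resp-⇔ S⇔S′ (T , T-rec , S⇔T) =
  T , T-rec , λ v → mk⇔ (λ x → to (S⇔T v) (from (S⇔S′ v) x)) (λ x → to (S⇔S′ v) (from (S⇔T v) x))

Listable⇒Σ₁ : ∀ {n S} → Listable n S → Σ₁ n S
Listable⇒Σ₁ (c , S⇔halts) = boundedEval c , boundedEval-recursive c , λ v → mk⇔
  (λ x → let y , e = to (S⇔halts v) x ; s₀ , later = boundedEval-complete e
         in s₀ , subst (0 <_) (sym (later s₀ ≤-refl)) z<s)
  (λ { (s , positive) → from (S⇔halts v) (halts s v positive) })
  where
    halts : ∀ s v → 0 < boundedEval c (s ∷ v) → ∃ λ y → Eval c v y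
    halts s v positive with boundedEval c (s ∷ v) in e
    ... | suc y = y , boundedEval-sound c s v y e

least-root : ∀ (g : ℕ → ℕ) s → g s ≡ 0 → ∃ λ y → g y ≡ 0 × (∀ z → z < y → ∃ λ w → g z ≡ suc w)
least-root g zero    g0≡0 = 0 , g0≡0 , λ _ ()
least-root g (suc s) gs≡0 with g 0 in g0
... | zero   = 0 , g0 , λ _ ()
... | suc w₀ with least-root (λ z → g (suc z)) s gs≡0
...   | y , gy≡0 , below = suc y , gy≡0 , λ { zero _ → w₀ , g0 ; (suc z) (s≤s z<y) → below z z<y }

Σ₁⇒Listable : ∀ {n S} → Σ₁ n S → Listable n S
Σ₁⇒Listable {n} {S} (T , T-rec , S⇔T) = mu c , λ v → mk⇔ (halts v) (member v)
  where
    isZero : Vec ℕ (suc n) → ℕ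
    isZero w = ifZero (T w) 1 0
    isZero-recursive : Recursive isZero
    isZero-recursive = recursive-by (ifZeroₑ (call T T-rec vars) (constₑ 1) (constₑ 0))
      λ w → cong (λ u → ifZero (T u) 1 0) (⟦vars⟧ w)
    c : PR (suc n)
    c = proj₁ isZero-recursive
    c-ok : ∀ w → Eval c w (isZero w)
    c-ok = proj₂ isZero-recursive
    halts : ∀ v → S v → ∃ λ y → Eval (mu c) v y
    halts v x with to (S⇔T v) x
    ... | s , positive with T (s ∷ v) in Ts
    ... | suc _ with least-root (λ z → isZero (z ∷ v)) s (cong (λ u → ifZero u 1 0) Ts)
    ... | y , root , below =
      y , mu-ev (subst (Eval c _) root (c-ok _))
                (λ z z<y → let w , e = below z z<y in w , subst (Eval c _) e (c-ok _))
    member : ∀ v → (∃ λ y → Eval (mu c) v y) → S v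
    member v (y , mu-ev e _) = from (S⇔T v) (y , positive (Eval-deterministic (c-ok (y ∷ v)) e))
      where
        positive : ifZero (T (y ∷ v)) 1 0 ≡ 0 → 0 < T (y ∷ v)
        positive eq with T (y ∷ v)
        ... | suc _ = z<s

Σ₁-preimage : ∀ {n m} {S : Vec ℕ m → Set} {g : Vec ℕ n → Vec ℕ m} →
              RecursiveVec g → Σ₁ m S → Σ₁ n (λ v → S (g v))
Σ₁-preimage {g = g} g-rec (T , T-rec , S⇔T) =
  (λ { (s ∷ v) → T (s ∷ g v) }) ,
  recursive-by (call T T-rec (#0 ∷ callVec g-rec (dropVars 1)))
    (λ { (s ∷ v) → cong (λ u → T (s ∷ u))
                        (trans (⟦callVec⟧ g-rec (dropVars 1) (s ∷ v)) (cong g (⟦dropVars⟧ (s ∷ []) v))) }) ,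
  λ v → S⇔T (g v)

sumUpTo : (ℕ → ℕ) → ℕ → ℕ
sumUpTo h zero    = h 0
sumUpTo h (suc s) = sumUpTo h s + h (suc s)

sumUpTo-pos : ∀ h {s′} s → s′ ≤ s → 0 < h s′ → 0 < sumUpTo h s
sumUpTo-pos h zero    z≤n positive = positive
sumUpTo-pos h (suc s) s′≤1+s positive with m≤n⇒m<n∨m≡n s′≤1+s
... | inj₁ (s≤s s′≤s) = ≤-trans (sumUpTo-pos h s s′≤s positive) (m≤m+n _ _)
... | inj₂ refl       = ≤-trans positive (m≤n+m _ _)

+-pos⇒ : ∀ a {b} → 0 < a + b → 0 < a ⊎ 0 < b
+-pos⇒ zero    positive = inj₂ positive
+-pos⇒ (suc a) _        = inj₁ z<s

sumUpTo-pos⇒ : ∀ h s → 0 < sumUpTo h s → ∃ λ s′ → 0 < h s′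
sumUpTo-pos⇒ h zero    positive = 0 , positive
sumUpTo-pos⇒ h (suc s) positive with +-pos⇒ (sumUpTo h s) positive
... | inj₁ earlier = sumUpTo-pos⇒ h s earlier
... | inj₂ last    = suc s , last

-- Makes the witnesses of T upward closed, so that one bound s can witness several conditions.
cumulative : ∀ {n} → (Vec ℕ (suc n) → ℕ) → Vec ℕ (suc n) → ℕ
cumulative T (s ∷ v) = sumUpTo (λ s′ → T (s′ ∷ v)) s

cumulative-recursive : ∀ {n} {T : Vec ℕ (suc n) → ℕ} → Recursive T → Recursive (cumulative T)
cumulative-recursive {T = T} T-rec = primRec-recursive
  (recursive-by (call T T-rec (constₑ 0 ∷ vars)) λ v → cong (λ u → T (0 ∷ u)) (⟦vars⟧ v))
  (⟦⟧-recursive (#1 +ₑ call T T-rec (sucₑ #0 ∷ dropVars 2)))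
  (λ v → refl)
  (λ s v → cong (λ u → cumulative T (s ∷ v) + T (suc s ∷ u))
                 (sym (⟦dropVars⟧ (s ∷ cumulative T (s ∷ v) ∷ []) v)))

whenPositive-pos : ∀ {a b} → 0 < a → 0 < b → 0 < whenPositive a b
whenPositive-pos {suc a} _ positive = positive

whenPositive-pos⇒ : ∀ a {b} → 0 < whenPositive a b → 0 < a × 0 < b
whenPositive-pos⇒ (suc a) positive = z<s , positive

Σ₁-× : ∀ {n} {S S′ : Vec ℕ n → Set} → Σ₁ n S → Σ₁ n S′ → Σ₁ n (λ v → S v × S′ v)
Σ₁-× {n} {S} {S′} (T , T-rec , S⇔T) (T′ , T′-rec , S′⇔T′) =
  both , both-recursive , λ v → mk⇔ (into v) (outof v)
  where
    both : Vec ℕ (suc n) → ℕ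
    both w = whenPositive (cumulative T w) (cumulative T′ w)
    both-recursive : Recursive both
    both-recursive = recursive-by
      (ifZeroₑ (call (cumulative T) (cumulative-recursive T-rec) vars) (constₑ 0)
               (call (cumulative T′) (cumulative-recursive T′-rec) vars))
      λ w → cong₂ (λ u u′ → whenPositive (cumulative T u) (cumulative T′ u′)) (⟦vars⟧ w) (⟦vars⟧ w)
    into : ∀ v → S v × S′ v → ∃ λ s → 0 < both (s ∷ v)
    into v (x , x′) with to (S⇔T v) x | to (S′⇔T′ v) x′
    ... | a , Ta | b , T′b =
      a ⊔ b , whenPositive-pos (sumUpTo-pos _ (a ⊔ b) (m≤m⊔n a b) Ta) (sumUpTo-pos _ (a ⊔ b) (m≤n⊔m a b) T′b)
    outof : ∀ v → (∃ λ s → 0 < both (s ∷ v)) → S v × S′ v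
    outof v (s , positive) with whenPositive-pos⇒ (cumulative T (s ∷ v)) positive
    ... | T≤s , T′≤s = from (S⇔T v) (sumUpTo-pos⇒ _ s T≤s) , from (S′⇔T′ v) (sumUpTo-pos⇒ _ s T′≤s)

Σ₁-⊎ : ∀ {n} {S S′ : Vec ℕ n → Set} → Σ₁ n S → Σ₁ n S′ → Σ₁ n (λ v → S v ⊎ S′ v)
Σ₁-⊎ {n} {S} {S′} (T , T-rec , S⇔T) (T′ , T′-rec , S′⇔T′) =
  either , either-recursive , λ v → mk⇔ (into v) (outof v)
  where
    either : Vec ℕ (suc n) → ℕ
    either w = T w + T′ w
    either-recursive : Recursive either
    either-recursive = recursive-by (call T T-rec vars +ₑ call T′ T′-rec vars)
      λ w → cong₂ (λ u u′ → T u + T′ u′) (⟦vars⟧ w) (⟦vars⟧ w)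
    into : ∀ v → S v ⊎ S′ v → ∃ λ s → 0 < either (s ∷ v)
    into v (inj₁ x) = let s , Ts = to (S⇔T v) x in s , ≤-trans Ts (m≤m+n _ _)
    into v (inj₂ x) = let s , T′s = to (S′⇔T′ v) x in s , ≤-trans T′s (m≤n+m _ _)
    outof : ∀ v → (∃ λ s → 0 < either (s ∷ v)) → S v ⊎ S′ v
    outof v (s , positive) with +-pos⇒ (T (s ∷ v)) positive
    ... | inj₁ Ts  = inj₁ (from (S⇔T v) (s , Ts))
    ... | inj₂ T′s = inj₂ (from (S′⇔T′ v) (s , T′s))

-- One bound s serves both for the witness m and for its own witness.
Σ₁-∃ : ∀ {n} {S : Vec ℕ (suc n) → Set} → Σ₁ (suc n) S → Σ₁ n (λ v → ∃ λ m → S (m ∷ v))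
Σ₁-∃ {n} {S} (T , T-rec , S⇔T) = E , E-recursive , λ v → mk⇔ (into v) (outof v)
  where
    U : Vec ℕ (2 + n) → ℕ
    U (m ∷ s ∷ v) = cumulative T (s ∷ m ∷ v)
    U-recursive : Recursive U
    U-recursive = recursive-by (call (cumulative T) (cumulative-recursive T-rec) (#1 ∷ #0 ∷ dropVars 2))
      λ { (m ∷ s ∷ v) → cong (λ u → cumulative T (s ∷ m ∷ u)) (⟦dropVars⟧ (m ∷ s ∷ []) v) }
    E : Vec ℕ (suc n) → ℕ
    E (s ∷ v) = cumulative U (s ∷ s ∷ v)
    E-recursive : Recursive E
    E-recursive = recursive-by (call (cumulative U) (cumulative-recursive U-recursive) (#0 ∷ #0 ∷ dropVars 1))
      λ { (s ∷ v) → cong (λ u → cumulative U (s ∷ s ∷ u)) (⟦dropVars⟧ (s ∷ []) v) }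
    into : ∀ v → (∃ λ m → S (m ∷ v)) → ∃ λ s → 0 < E (s ∷ v)
    into v (m , x) with to (S⇔T (m ∷ v)) x
    ... | s′ , Ts′ =
      m ⊔ s′ , sumUpTo-pos _ (m ⊔ s′) (m≤m⊔n m s′) (sumUpTo-pos _ (m ⊔ s′) (m≤n⊔m m s′) Ts′)
    outof : ∀ v → (∃ λ s → 0 < E (s ∷ v)) → ∃ λ m → S (m ∷ v)
    outof v (s , positive) with sumUpTo-pos⇒ _ s positive
    ... | m , Um = m , from (S⇔T (m ∷ v)) (sumUpTo-pos⇒ _ s Um)

Σ₁-⊤ : ∀ {n} → Σ₁ n (λ _ → ⊤)
Σ₁-⊤ = (λ _ → 1) , recursive-by (constₑ 1) (λ _ → refl) , λ v → mk⇔ (λ _ → 0 , z<s) (λ _ → tt)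

Σ₁-∃Vec : ∀ k {n} {S : Vec ℕ (k + n) → Set} → Σ₁ (k + n) S → Σ₁ n (λ v → ∃ λ u → S (u ++ v))
Σ₁-∃Vec zero    S-Σ₁ = Σ₁-resp-⇔ (λ v → mk⇔ (λ x → [] , x) (λ { ([] , x) → x })) S-Σ₁
Σ₁-∃Vec (suc k) S-Σ₁ = Σ₁-resp-⇔ (λ v → mk⇔ (λ { (u , m , x) → m ∷ u , x })
                                              (λ { (m ∷ u , x) → u , m , x }))
                                  (Σ₁-∃Vec k (Σ₁-∃ S-Σ₁))

take-++ : ∀ {A : Set} {k n} (u : Vec A k) (w : Vec A n) → take k (u ++ w) ≡ u
take-++ []      w = refl
take-++ (x ∷ u) w = cong (x ∷_) (take-++ u w)

drop-++ : ∀ {A : Set} {k n} (u : Vec A k) (w : Vec A n) → drop k (u ++ w) ≡ w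
drop-++ []      w = refl
drop-++ (x ∷ u) w = drop-++ u w

take-drop-++⇔ : ∀ {A : Set} {k n} (P : Vec A k → Vec A n → Set) (u : Vec A k) (w : Vec A n) →
                P (take k (u ++ w)) (drop k (u ++ w)) ⇔ P u w
take-drop-++⇔ P u w = mk⇔ (subst₂ P (take-++ u w) (drop-++ u w)) (subst₂ P (sym (take-++ u w)) (sym (drop-++ u w)))

takeVars : ∀ k {n} → Vec (Expr (k + n)) k
takeVars k {n} = tabulate (λ i → var (i ↑ˡ n))

⟦takeVars⟧ : ∀ {k n} (u : Vec ℕ k) (v : Vec ℕ n) → ⟦ takeVars k ⟧* (u ++ v) ≡ u
⟦takeVars⟧ u v = trans (⟦tabulate⟧* _ (u ++ v)) (trans (tabulate-cong (lookup-++ˡ u v)) (tabulate∘lookup u))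

take-recursive : ∀ k {n} → RecursiveVec (take k {n})
take-recursive k = recursiveVec-by (takeVars k) λ w →
  trans (cong ⟦ takeVars k ⟧* (sym (take++drop≡id k w))) (⟦takeVars⟧ (take k w) (drop k w))

drop-recursive : ∀ k {n} → RecursiveVec (drop k {n})
drop-recursive k = recursiveVec-by (dropVars k) λ w →
  trans (cong ⟦ dropVars k ⟧* (sym (take++drop≡id k w))) (⟦dropVars⟧ (take k w) (drop k w))

tail-recursive : ∀ {n} → RecursiveVec (tail {n = n})
tail-recursive = recursiveVec-by (dropVars 1) λ { (x ∷ v) → ⟦dropVars⟧ (x ∷ []) v }

head-recursive : ∀ {n} → RecursiveVec {suc n} (λ v → lookup v zero ∷ [])
head-recursive = recursiveVec-by (#0 ∷ []) λ { (x ∷ v) → refl }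

∘-recursiveVec : ∀ {n m k} {F : Vec ℕ m → Vec ℕ k} {G : Vec ℕ n → Vec ℕ m} →
                 RecursiveVec F → RecursiveVec G → RecursiveVec (λ v → F (G v))
∘-recursiveVec {F = F} {G} F-rec G-rec =
  recursiveVec-by (callVec F-rec (callVec G-rec vars))
    λ v → trans (⟦callVec⟧ F-rec _ v) (cong F (trans (⟦callVec⟧ G-rec vars v) (cong G (⟦vars⟧ v))))

++-recursive : ∀ {n m k} {F : Vec ℕ n → Vec ℕ m} {G : Vec ℕ n → Vec ℕ k} →
               RecursiveVec F → RecursiveVec G → RecursiveVec (λ v → F v ++ G v)
++-recursive {n} (cs , cs-ok) (ds , ds-ok) = cs ++ ds , λ v → go (cs-ok v) (ds-ok v)
  where
    go : ∀ {j l} {cs : Vec (PR n) j} {ds : Vec (PR n) l} {v ys zs} →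
         EvalVec cs v ys → EvalVec ds v zs → EvalVec (cs ++ ds) v (ys ++ zs)
    go []       d = d
    go (e ∷ es) d = e ∷ go es d

RecursiveVec⇒TotalRecursive : ∀ {r} {f : ℕ → Vec ℕ r} →
                              RecursiveVec (λ v → f (lookup v zero)) → TotalRecursive f
RecursiveVec⇒TotalRecursive (cs , cs-ok) = cs , λ n i → EvalVec-lookup (cs-ok (n ∷ [])) i

TotalRecursive⇒RecursiveVec : ∀ {r} {f : ℕ → Vec ℕ r} →
                              TotalRecursive f → RecursiveVec (λ v → f (lookup v zero))
TotalRecursive⇒RecursiveVec {f = f} (cs , cs-ok) =
  cs , λ { (n ∷ []) → lookup-EvalVec cs (f n) (cs-ok n) }

-- Positive existential sets under a listable presentation

≡⇒⇔ : ∀ {A : Set} (P : A → Set) {x y} → x ≡ y → P x ⇔ P y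
≡⇒⇔ P x≡y = mk⇔ (subst P x≡y) (subst P (sym x≡y))

module ListablePresentation {L : Language} (M : Structure L) (ρ : ℕ → Structure.Carrier M)
                            (presentation : IsListablePresentation M ρ) where
  open Language L
  open Structure M renaming (Carrier to C; rel to relᴹ)
  open IsListablePresentation presentation

  surjective-vec : ∀ {k} (u : Vec C k) → ∃ λ w → map ρ w ≡ u
  surjective-vec []      = [] , refl
  surjective-vec (x ∷ u) with surjective x | surjective-vec u
  ... | a , ρa≡x | w , ρw≡u = a ∷ w , cong₂ _∷_ ρa≡x ρw≡u

  TermGraph : ∀ {n} → Term n → Vec ℕ (suc n) → Set
  TermGraph t (j ∷ w) = ρ j ≡ evalT M t (map ρ w)

  TermsGraph : ∀ {n k} → Vec (Term n) k → Vec ℕ (k + n) → Set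
  TermsGraph {k = k} ts x = map ρ (take k x) ≡ evalTs M ts (map ρ (drop k x))

  TermsGraph-++ : ∀ {n k} (ts : Vec (Term n) k) (u : Vec ℕ k) w →
                  TermsGraph ts (u ++ w) ⇔ (map ρ u ≡ evalTs M ts (map ρ w))
  TermsGraph-++ {n} {k} ts u w = take-drop-++⇔ Denotes u w
    where
      Denotes : Vec ℕ k → Vec ℕ n → Set
      Denotes a b = map ρ a ≡ evalTs M ts (map ρ b)

  mutual
    termGraph-Σ₁ : ∀ {n} (t : Term n) → Σ₁ (suc n) (TermGraph t)
    termGraph-Σ₁ (var i) =
      Σ₁-resp-⇔ (λ { (j ∷ w) → ≡⇒⇔ (ρ j ≡_) (sym (lookup-map i ρ w)) })
        (Σ₁-preimage {g = λ { (j ∷ w) → j ∷ lookup w i ∷ [] }}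
                     (recursiveVec-by (#0 ∷ var (suc i) ∷ []) λ { (j ∷ w) → refl })
                     (Listable⇒Σ₁ eq-listable))
    termGraph-Σ₁ {n} (app f ts) =
      Σ₁-resp-⇔ (λ { (j ∷ w) → graph⇔ j w })
        (Σ₁-∃Vec k (Σ₁-× (Σ₁-preimage args-recursive (termsGraph-Σ₁ ts))
                         (Σ₁-preimage graphArgs-recursive (Listable⇒Σ₁ (fun-listable f)))))
      where
        k : ℕ
        k = funArity f
        args : Vec ℕ (k + suc n) → Vec ℕ (k + n)
        args x = take k x ++ tail (drop k x)
        args-recursive : RecursiveVec args
        args-recursive = ++-recursive (take-recursive k) (∘-recursiveVec tail-recursive (drop-recursive k))
        args-++ : ∀ u j w → args (u ++ j ∷ w) ≡ u ++ w
        args-++ u j w = cong₂ _++_ (take-++ u (j ∷ w)) (cong tail (drop-++ u (j ∷ w)))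
        graphArgs : Vec ℕ (k + suc n) → Vec ℕ (suc k)
        graphArgs x = lookup (drop k x) zero ∷ take k x
        graphArgs-recursive : RecursiveVec graphArgs
        graphArgs-recursive = ∷-recursive (∘-recursive (lookup-recursive zero) (drop-recursive k)) (take-recursive k)
        graphArgs-++ : ∀ u j w → graphArgs (u ++ j ∷ w) ≡ j ∷ u
        graphArgs-++ u j w = cong₂ _∷_ (cong (λ z → lookup z zero) (drop-++ u (j ∷ w))) (take-++ u (j ∷ w))
        graph⇔ : ∀ j w → (∃ λ u → TermsGraph ts (args (u ++ j ∷ w))
                                 × pre ρ (Graph M f) (graphArgs (u ++ j ∷ w)))
                         ⇔ TermGraph (app f ts) (j ∷ w)
        graph⇔ j w = mk⇔
          (λ { (u , A , B) →
               let ρu≡ = to (TermsGraph-++ ts u w) (subst (TermsGraph ts) (args-++ u j w) A)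
                   fρu≡ρj = subst (pre ρ (Graph M f)) (graphArgs-++ u j w) B
               in trans (sym fρu≡ρj) (cong (fun f) ρu≡) })
          (λ ρj≡ → let u , ρu≡ = surjective-vec (evalTs M ts (map ρ w)) in
               u , subst (TermsGraph ts) (sym (args-++ u j w)) (from (TermsGraph-++ ts u w) ρu≡) ,
                   subst (pre ρ (Graph M f)) (sym (graphArgs-++ u j w)) (trans (cong (fun f) ρu≡) (sym ρj≡)))

    termsGraph-Σ₁ : ∀ {n k} (ts : Vec (Term n) k) → Σ₁ (k + n) (TermsGraph ts)
    termsGraph-Σ₁ []       = Σ₁-resp-⇔ (λ v → mk⇔ (λ _ → refl) (λ _ → tt)) Σ₁-⊤
    termsGraph-Σ₁ {n} {suc k} (t ∷ ts) =
      Σ₁-resp-⇔ (λ { (j ∷ y) → mk⇔ (λ (head , rest) → cong₂ _∷_ head rest) ∷-injective })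
        (Σ₁-× (Σ₁-preimage (∷-recursive (lookup-recursive zero)
                                        (∘-recursiveVec (drop-recursive k) tail-recursive))
                           (termGraph-Σ₁ t))
              (Σ₁-preimage tail-recursive (termsGraph-Σ₁ ts)))

  satisfaction-Σ₁ : ∀ {n} (φ : PEFormula n) → Σ₁ n (λ w → Sat M φ (map ρ w))
  satisfaction-Σ₁ (s ≐ t) = Σ₁-resp-⇔ equal⇔ (Σ₁-∃ (Σ₁-× (termGraph-Σ₁ s) (termGraph-Σ₁ t)))
    where
      equal⇔ : ∀ w → (∃ λ j → TermGraph s (j ∷ w) × TermGraph t (j ∷ w)) ⇔ Sat M (s ≐ t) (map ρ w)
      equal⇔ w = mk⇔ (λ (j , ρj≡s , ρj≡t) → trans (sym ρj≡s) ρj≡t)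
                     (λ s≡t → let j , ρj≡s = surjective (evalT M s (map ρ w)) in j , ρj≡s , trans ρj≡s s≡t)
  satisfaction-Σ₁ (rel R ts) =
    Σ₁-resp-⇔ holds⇔ (Σ₁-∃Vec _ (Σ₁-× (termsGraph-Σ₁ ts)
                                       (Σ₁-preimage (take-recursive _) (Listable⇒Σ₁ (rel-listable R)))))
    where
      holds⇔ : ∀ w → (∃ λ u → TermsGraph ts (u ++ w) × relᴹ R (map ρ (take (relArity R) (u ++ w))))
                       ⇔ Sat M (rel R ts) (map ρ w)
      holds⇔ w = mk⇔
        (λ (u , ρu≡ , Rρu) → subst (relᴹ R) (to (TermsGraph-++ ts u w) ρu≡)
                                           (subst (λ z → relᴹ R (map ρ z)) (take-++ u w) Rρu))
        (λ R⟦ts⟧ → let u , ρu≡ = surjective-vec (evalTs M ts (map ρ w)) in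
           u , from (TermsGraph-++ ts u w) ρu≡ ,
           subst (λ z → relᴹ R (map ρ z)) (sym (take-++ u w)) (subst (relᴹ R) (sym ρu≡) R⟦ts⟧))
  satisfaction-Σ₁ (φ ∧' ψ) = Σ₁-× (satisfaction-Σ₁ φ) (satisfaction-Σ₁ ψ)
  satisfaction-Σ₁ (φ ∨' ψ) = Σ₁-⊎ (satisfaction-Σ₁ φ) (satisfaction-Σ₁ ψ)
  satisfaction-Σ₁ (∃' φ)   = Σ₁-resp-⇔ exists⇔ (Σ₁-∃ (satisfaction-Σ₁ φ))
    where
      exists⇔ : ∀ w → (∃ λ m → Sat M φ (map ρ (m ∷ w))) ⇔ Sat M (∃' φ) (map ρ w)
      exists⇔ w = mk⇔ (λ (m , x) → ρ m , x)
                      (λ (c , x) → let m , ρm≡c = surjective c in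
                                   m , subst (λ z → Sat M φ (z ∷ map ρ w)) (sym ρm≡c) x)

  PEDefinable⇒Σ₁ : ∀ {n} {X : Vec C n → Set} → PEDefinable M X → Σ₁ n (pre ρ X)
  PEDefinable⇒Σ₁ (φ , X⇔φ) =
    Σ₁-resp-⇔ (λ w → mk⇔ (from (X⇔φ (map ρ w))) (to (X⇔φ (map ρ w)))) (satisfaction-Σ₁ φ)

-- Enumerating a nonempty Σ₁ set

⌊√_⌋ : ℕ → ℕ
⌊√ zero  ⌋ = 0
⌊√ suc n ⌋ = ifZero (suc ⌊√ n ⌋ * suc ⌊√ n ⌋ ∸ suc n) (suc ⌊√ n ⌋) ⌊√ n ⌋

⌊√⌋-bounds : ∀ n → ⌊√ n ⌋ * ⌊√ n ⌋ ≤ n × n < suc ⌊√ n ⌋ * suc ⌊√ n ⌋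
⌊√⌋-bounds zero = z≤n , z<s
⌊√⌋-bounds (suc n) with ⌊√⌋-bounds n
... | lower , upper with suc ⌊√ n ⌋ * suc ⌊√ n ⌋ ∸ suc n in gap
...   | zero  = m∸n≡0⇒m≤n gap ,
                ≤-trans (s≤s upper) (*-mono-< (n<1+n (suc ⌊√ n ⌋)) (n<1+n (suc ⌊√ n ⌋)))
...   | suc _ = m≤n⇒m≤1+n lower , ≰⇒> (λ le → 0≢1+n (trans (sym (m≤n⇒m∸n≡0 le)) gap))

⌊√⌋-unique : ∀ {b c} n → b * b ≤ n → n < suc b * suc b → c * c ≤ n → n < suc c * suc c → b ≡ c
⌊√⌋-unique {b} {c} n b²≤n n<[1+b]² c²≤n n<[1+c]² with <-cmp b c
... | tri≈ _ b≡c _ = b≡c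
... | tri< b<c _ _ = ⊥-elim (<-irrefl refl (≤-trans n<[1+b]² (≤-trans (*-mono-≤ b<c b<c) c²≤n)))
... | tri> _ _ c<b = ⊥-elim (<-irrefl refl (≤-trans n<[1+c]² (≤-trans (*-mono-≤ c<b c<b) b²≤n)))

⌊√⌋-square+ : ∀ b a → a ≤ b + b → ⌊√ b * b + a ⌋ ≡ b
⌊√⌋-square+ b a a≤2b =
  sym (⌊√⌋-unique (b * b + a) (m≤m+n _ _) below (proj₁ (⌊√⌋-bounds _)) (proj₂ (⌊√⌋-bounds _)))
  where
    open ≤-Reasoning
    below : b * b + a < suc b * suc b
    below = begin-strict
      b * b + a           ≤⟨ +-monoʳ-≤ (b * b) a≤2b ⟩
      b * b + (b + b)     <⟨ n<1+n _ ⟩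
      suc (b * b + (b + b)) ≡⟨ cong suc (trans (+-comm (b * b) (b + b))
                                 (trans (+-assoc b b (b * b)) (cong (b +_) (sym (*-suc b b))))) ⟩
      suc b * suc b       ∎

-- The square (x + y)² is the largest one below pair x y, because x ≤ 2 (x + y).
pair : ℕ → ℕ → ℕ
pair x y = (x + y) * (x + y) + x

unpair₁ : ℕ → ℕ
unpair₁ n = n ∸ ⌊√ n ⌋ * ⌊√ n ⌋

unpair₂ : ℕ → ℕ
unpair₂ n = ⌊√ n ⌋ ∸ unpair₁ n

unpair-pair : ∀ x y → unpair₁ (pair x y) ≡ x × unpair₂ (pair x y) ≡ y
unpair-pair x y = first , trans (cong₂ _∸_ √pair first) (m+n∸m≡n x y)
  where
    √pair : ⌊√ pair x y ⌋ ≡ x + y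
    √pair = ⌊√⌋-square+ (x + y) x (≤-trans (m≤m+n x y) (m≤m+n (x + y) (x + y)))
    first : unpair₁ (pair x y) ≡ x
    first = trans (cong (λ q → pair x y ∸ q * q) √pair) (m+n∸m≡n ((x + y) * (x + y)) x)

⌊√⌋-recursive : Recursive (uncurry₁ ⌊√_⌋)
⌊√⌋-recursive = primRec-recursive zero-recursive
  (⟦⟧-recursive (ifZeroₑ (sucₑ #1 *ₑ sucₑ #1 ∸ₑ sucₑ #0) (sucₑ #1) #1))
  (λ { [] → refl }) (λ { n [] → refl })

√ₑ : ∀ {n} → Expr n → Expr n
√ₑ a = call (uncurry₁ ⌊√_⌋) ⌊√⌋-recursive (a ∷ [])

unpair₁-recursive : Recursive (uncurry₁ unpair₁)
unpair₁-recursive = recursive-by (#0 ∸ₑ √ₑ #0 *ₑ √ₑ #0) λ { (n ∷ []) → refl }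

unpair₂-recursive : Recursive (uncurry₁ unpair₂)
unpair₂-recursive = recursive-by (√ₑ #0 ∸ₑ call (uncurry₁ unpair₁) unpair₁-recursive (#0 ∷ []))
                                 λ { (n ∷ []) → refl }

decode : ∀ k → ℕ → Vec ℕ k
decode zero    n = []
decode (suc k) n = unpair₁ n ∷ decode k (unpair₂ n)

decode-surjective : ∀ {k} (u : Vec ℕ k) → ∃ λ n → decode k n ≡ u
decode-surjective []      = 0 , refl
decode-surjective (x ∷ u) with decode-surjective u
... | m , decoded = pair x m , cong₂ _∷_ (proj₁ (unpair-pair x m))
                                         (trans (cong (decode _) (proj₂ (unpair-pair x m))) decoded)

unpair₂-recursiveVec : RecursiveVec (λ v → unpair₂ (lookup v zero) ∷ [])
unpair₂-recursiveVec = ∷-recursive (Recursive-resp (λ { (n ∷ []) → refl }) unpair₂-recursive) []-recursive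

decode-recursive : ∀ k → RecursiveVec (λ v → decode k (lookup v zero))
decode-recursive zero    = []-recursive
decode-recursive (suc k) = ∷-recursive (Recursive-resp (λ { (n ∷ []) → refl }) unpair₁-recursive)
                                       (∘-recursiveVec (decode-recursive k) unpair₂-recursiveVec)

const-recursiveVec : ∀ {n m} (a : Vec ℕ m) → RecursiveVec {n} (λ _ → a)
const-recursiveVec []      = []-recursive
const-recursiveVec (x ∷ a) = ∷-recursive (recursive-by (constₑ x) (⟦constₑ⟧ x)) (const-recursiveVec a)

tabulate-ifZero : ∀ {m} c (a b : Vec ℕ m) → tabulate (λ i → ifZero c (lookup a i) (lookup b i)) ≡ ifZero c a b
tabulate-ifZero zero    a b = tabulate∘lookup a
tabulate-ifZero (suc _) a b = tabulate∘lookup b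

ifZero-recursiveVec : ∀ {n m} {F : Vec ℕ n → ℕ} {G H : Vec ℕ n → Vec ℕ m} →
                      Recursive F → RecursiveVec G → RecursiveVec H →
                      RecursiveVec (λ v → ifZero (F v) (G v) (H v))
ifZero-recursiveVec {F = F} {G} {H} F-rec G-rec H-rec =
  recursiveVec-by (tabulate λ i → ifZeroₑ (call F F-rec vars)
                                          (call (λ v → lookup (G v) i) (component-recursive G-rec i) vars)
                                          (call (λ v → lookup (H v) i) (component-recursive H-rec i) vars))
    λ v → trans (⟦tabulate⟧* _ v)
                (trans (cong (λ u → tabulate (λ i → ifZero (F u) (lookup (G u) i) (lookup (H u) i))) (⟦vars⟧ v))
                       (tabulate-ifZero (F v) (G v) (H v)))

-- n is read as a pair (s, a): the output is a when s witnesses a ∈ X, and the fixed a₀ otherwise.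
enumerate : ∀ {r} {X : Vec ℕ r → Set} → Σ₁ r X → ∀ {a₀} → X a₀ →
            ∃ λ f → TotalRecursive f × HasImage f X
enumerate {r} {X} (T , T-rec , X⇔T) {a₀} x₀ = f , RecursiveVec⇒TotalRecursive {f = f} f-recursive , image
  where
    f : ℕ → Vec ℕ r
    f n = ifZero (T (decode (suc r) n)) a₀ (decode r (unpair₂ n))
    f-recursive : RecursiveVec (λ v → f (lookup v zero))
    f-recursive = ifZero-recursiveVec (∘-recursive T-rec (decode-recursive (suc r))) (const-recursiveVec a₀)
                                      (∘-recursiveVec (decode-recursive r) unpair₂-recursiveVec)
    image : HasImage f X
    image a = mk⇔ listed member
      where
        listed : X a → ∃ λ n → f n ≡ a
        listed x with to (X⇔T a) x
        ... | s , positive with decode-surjective (s ∷ a)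
        ... | n , decoded with T (decode (suc r) n) in Tn
        ... | zero  = ⊥-elim (<-irrefl refl (subst (0 <_) (trans (cong T (sym decoded)) Tn) positive))
        ... | suc _ = n , trans (cong (λ c → ifZero c a₀ (decode r (unpair₂ n))) Tn) (proj₂ (∷-injective decoded))
        member : (∃ λ n → f n ≡ a) → X a
        member (n , fn≡a) with T (decode (suc r) n) in Tn
        ... | zero  = subst X fn≡a x₀
        ... | suc _ = subst X fn≡a (from (X⇔T _) (unpair₁ n , subst (0 <_) (sym Tn) z<s))

-- The presentation induced by a p.e. interpretation

concat-injective : ∀ {A : Set} {k r} (vs ws : Vec (Vec A r) k) → concat vs ≡ concat ws → vs ≡ ws
concat-injective []       []       _  = refl
concat-injective (v ∷ vs) (w ∷ ws) eq =
  let v≡w , rest = ++-injective v w eq in cong₂ _∷_ v≡w (concat-injective vs ws rest)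

blocks : ∀ {A : Set} k {r} → Vec A (k * r) → Vec (Vec A r) k
blocks zero    w = []
blocks (suc k) {r} w = take r w ∷ blocks k (drop r w)

concat-blocks : ∀ {A : Set} k {r} (w : Vec A (k * r)) → concat (blocks k w) ≡ w
concat-blocks zero    [] = refl
concat-blocks (suc k) {r} w = trans (cong (take r w ++_) (concat-blocks k (drop r w))) (take++drop≡id r w)

blocks-concat : ∀ {A : Set} k {r} (vs : Vec (Vec A r) k) → blocks k (concat vs) ≡ vs
blocks-concat zero    []       = refl
blocks-concat (suc k) (v ∷ vs) =
  cong₂ _∷_ (take-++ v (concat vs)) (trans (cong (blocks k) (drop-++ v (concat vs))) (blocks-concat k vs))

module Interpretation {L₁ L₂ : Language} {M₁ : Structure L₁} {M₂ : Structure L₂} {r : ℕ}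
  (Θ : PEInterpretation M₁ M₂ r) (ρ : ℕ → Structure.Carrier M₁) (presentation : IsListablePresentation M₁ ρ)
  (f : ℕ → Vec ℕ r) (f-total : TotalRecursive f) (image : HasImage f (domPre Θ ρ)) where

  open PEInterpretation Θ
  open Structure M₁ using () renaming (Carrier to C₁)
  open Structure M₂ using () renaming (Carrier to C₂)
  open ListablePresentation M₁ ρ presentation using (surjective-vec; PEDefinable⇒Σ₁)

  γ : ℕ → C₂
  γ = gamma Θ ρ f image

  dom-f : ∀ n → dom (map ρ (f n))
  dom-f n = from (image (f n)) (n , refl)

  θ-cong : ∀ {u u′} → u ≡ u′ → (d : dom u) (d′ : dom u′) → θ u d ≡ θ u′ d′
  θ-cong refl d d′ = refl

  γ-covers-θ : ∀ v (d : dom v) → ∃ λ n → γ n ≡ θ v d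
  γ-covers-θ v d with surjective-vec v
  ... | b , ρb≡v with to (image b) (subst dom (sym ρb≡v) d)
  ... | n , fn≡b = n , θ-cong (trans (cong (map ρ) fn≡b) ρb≡v) (dom-f n) d

  f-recursive : RecursiveVec (λ v → f (lookup v zero))
  f-recursive = TotalRecursive⇒RecursiveVec {f = f} f-total

  flatten : ∀ {k} → Vec ℕ k → Vec ℕ (k * r)
  flatten ns = concat (map f ns)

  flatten-recursive : ∀ k → RecursiveVec (flatten {k})
  flatten-recursive zero    = RecursiveVec-resp (λ { [] → refl }) []-recursive
  flatten-recursive (suc k) = RecursiveVec-resp (λ { (n ∷ ns) → refl })
    (++-recursive (∘-recursiveVec f-recursive head-recursive) (∘-recursiveVec (flatten-recursive k) tail-recursive))

  f-tuples : ∀ {k} → Vec ℕ k → Vec (Vec (C₁) r) k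
  f-tuples ns = map (λ n → map ρ (f n)) ns

  map-flatten : ∀ {k} (ns : Vec ℕ k) → map ρ (flatten ns) ≡ concat (f-tuples ns)
  map-flatten []       = refl
  map-flatten (n ∷ ns) = trans (map-++ ρ (f n) (flatten ns)) (cong (map ρ (f n) ++_) (map-flatten ns))

  θ-f-tuples : ∀ {k} (ns : Vec ℕ k) vs ds → vs ≡ f-tuples ns → mapDom dom θ vs ds ≡ map γ ns
  θ-f-tuples []       []       []       _  = refl
  θ-f-tuples (n ∷ ns) (v ∷ vs) (d ∷ ds) eq =
    let v≡ , vs≡ = ∷-injective eq in cong₂ _∷_ (θ-cong v≡ d (dom-f n)) (θ-f-tuples ns vs ds vs≡)

  dom-f-tuples : ∀ {k} (ns : Vec ℕ k) → All dom (f-tuples ns)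
  dom-f-tuples []       = []
  dom-f-tuples (n ∷ ns) = dom-f n ∷ dom-f-tuples ns

  θ*-flatten : ∀ {k} {S : Vec (C₂) k → Set} ns → pre ρ (θ* S) (flatten ns) ⇔ pre γ S ns
  θ*-flatten {S = S} ns = mk⇔
    (λ (vs , concat≡ , ds , s) →
       subst S (θ-f-tuples ns vs ds (concat-injective vs (f-tuples ns) (trans concat≡ (map-flatten ns)))) s)
    (λ s → f-tuples ns , sym (map-flatten ns) , dom-f-tuples ns ,
           subst S (sym (θ-f-tuples ns (f-tuples ns) (dom-f-tuples ns) refl)) s)

  θ*-Σ₁⇒γ-Σ₁ : ∀ {k} {S : Vec (C₂) k → Set} → Σ₁ (k * r) (pre ρ (θ* S)) → Σ₁ k (pre γ S)
  θ*-Σ₁⇒γ-Σ₁ {k} {S} θ*S-Σ₁ =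
    Σ₁-resp-⇔ (θ*-flatten {S = S}) (Σ₁-preimage (flatten-recursive k) θ*S-Σ₁)

  SameImage : Vec ℕ r → ℕ → Set
  SameImage b n = pre ρ (θ* (EqRel M₂)) (b ++ (f n ++ []))

  MapsTo : Vec (C₁) r → ℕ → Set
  MapsTo v n = Σ (dom v) λ d → θ v d ≡ γ n

  SameImage⇔ : ∀ b n → SameImage b n ⇔ MapsTo (map ρ b) n
  SameImage⇔ b n = mk⇔ into outof
    where
      map-split : map ρ (b ++ (f n ++ [])) ≡ map ρ b ++ (map ρ (f n) ++ [])
      map-split = trans (map-++ ρ b _) (cong (map ρ b ++_) (map-++ ρ (f n) []))
      into : SameImage b n → MapsTo (map ρ b) n
      into ((u₁ ∷ u₂ ∷ []) , concat≡ , (d₁ ∷ d₂ ∷ []) , θu₁≡θu₂) =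
        let u₁≡ , rest = ++-injective u₁ (map ρ b) (trans concat≡ map-split)
            u₂≡ = proj₁ (++-injective u₂ (map ρ (f n)) rest)
        in subst dom u₁≡ d₁ ,
           trans (θ-cong (sym u₁≡) (subst dom u₁≡ d₁) d₁) (trans θu₁≡θu₂ (θ-cong u₂≡ d₂ (dom-f n)))
      outof : MapsTo (map ρ b) n → SameImage b n
      outof (d , θ≡γ) = (map ρ b ∷ map ρ (f n) ∷ []) , sym map-split , (d ∷ dom-f n ∷ []) , θ≡γ

  Matches : ∀ {k} → Vec ℕ k → Vec ℕ (k * r) → Set
  Matches []       w = ⊤
  Matches (n ∷ ns) w = SameImage (take r w) n × Matches ns (drop r w)

  Matches-Σ₁ : ∀ k → Σ₁ (k + k * r) (λ x → Matches (take k x) (drop k x))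
  Matches-Σ₁ zero    = Σ₁-⊤
  Matches-Σ₁ (suc k) = Σ₁-resp-⇔ (λ { (n ∷ y) → split⇔ n y })
    (Σ₁-× (Σ₁-preimage {g = λ { (n ∷ y) → take r (drop k y) ++ (f n ++ []) }}
            (RecursiveVec-resp (λ { (n ∷ y) → refl })
              (++-recursive (∘-recursiveVec (take-recursive r) (∘-recursiveVec (drop-recursive k) tail-recursive))
                            (++-recursive (∘-recursiveVec f-recursive head-recursive) []-recursive)))
            (PEDefinable⇒Σ₁ eq-pe))
          (Σ₁-preimage {g = λ { (n ∷ y) → take k y ++ drop r (drop k y) }}
            (RecursiveVec-resp (λ { (n ∷ y) → refl })
              (++-recursive (∘-recursiveVec (take-recursive k) tail-recursive)
                            (∘-recursiveVec (drop-recursive r) (∘-recursiveVec (drop-recursive k) tail-recursive))))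
            (Matches-Σ₁ k)))
    where
      split⇔ : ∀ n y → let rest = take k y ++ drop r (drop k y) in
                       (SameImage (take r (drop k y)) n × Matches (take k rest) (drop k rest))
                       ⇔ Matches (take (suc k) (n ∷ y)) (drop (suc k) (n ∷ y))
      split⇔ n y = mk⇔ (λ (here , rest) → here , to (take-drop-++⇔ Matches (take k y) _) rest)
                       (λ (here , rest) → here , from (take-drop-++⇔ Matches (take k y) _) rest)

  Represents : ∀ {k} → Vec (Vec (C₁) r) k → Vec ℕ k → Set
  Represents vs ns = Σ (All dom vs) λ ds → mapDom dom θ vs ds ≡ map γ ns

  Represents-∷ : ∀ {k} u (us : Vec (Vec (C₁) r) k) n ns →
                 Represents (u ∷ us) (n ∷ ns) ⇔ (MapsTo u n × Represents us ns)
  Represents-∷ u us n ns = mk⇔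
    (λ { ((d ∷ ds) , eq) → (d , proj₁ (∷-injective eq)) , (ds , proj₂ (∷-injective eq)) })
    (λ { ((d , θu≡γn) , (ds , rest)) → (d ∷ ds) , cong₂ _∷_ θu≡γn rest })

  Matches⇔Represents : ∀ {k} (ns : Vec ℕ k) (w : Vec ℕ (k * r)) →
                       Matches ns w ⇔ Represents (blocks k (map ρ w)) ns
  Matches⇔Represents []       [] = mk⇔ (λ _ → [] , refl) (λ _ → tt)
  Matches⇔Represents {suc k} (n ∷ ns) w = mk⇔
    (λ (here , rest) → from (Represents-∷ _ _ n ns)
       (subst (λ z → MapsTo z n) (sym (take-map ρ r w)) (to (SameImage⇔ (take r w) n) here) ,
        subst (λ z → Represents (blocks k z) ns) (sym (drop-map ρ r w)) (to (Matches⇔Represents ns (drop r w)) rest)))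
    (λ represents → let here , rest = to (Represents-∷ _ _ n ns) represents in
       from (SameImage⇔ (take r w) n) (subst (λ z → MapsTo z n) (take-map ρ r w) here) ,
       from (Matches⇔Represents ns (drop r w)) (subst (λ z → Represents (blocks k z) ns) (drop-map ρ r w) rest))

  γ-covers-θ* : ∀ {k} (vs : Vec (Vec (C₁) r) k) (ds : All dom vs) →
                ∃ λ ns → mapDom dom θ vs ds ≡ map γ ns
  γ-covers-θ* []       []       = [] , refl
  γ-covers-θ* (v ∷ vs) (d ∷ ds) with γ-covers-θ v d | γ-covers-θ* vs ds
  ... | n , γn≡θv | ns , rest = n ∷ ns , cong₂ _∷_ (sym γn≡θv) rest

  γ-Σ₁⇒θ*-Σ₁ : ∀ {k} {S : Vec (C₂) k → Set} → Σ₁ k (pre γ S) → Σ₁ (k * r) (pre ρ (θ* S))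
  γ-Σ₁⇒θ*-Σ₁ {k} {S} γS-Σ₁ =
    Σ₁-resp-⇔ witnessed⇔ (Σ₁-∃Vec k (Σ₁-× (Σ₁-preimage (take-recursive k) γS-Σ₁) (Matches-Σ₁ k)))
    where
      witnessed⇔ : ∀ w → (∃ λ ns → pre γ S (take k (ns ++ w)) × Matches (take k (ns ++ w)) (drop k (ns ++ w)))
                         ⇔ pre ρ (θ* S) w
      witnessed⇔ w = mk⇔
        (λ (ns , s , matches) →
           let ds , θ≡γ = to (Matches⇔Represents ns w) (to (take-drop-++⇔ Matches ns w) matches)
           in blocks k (map ρ w) , concat-blocks k (map ρ w) , ds ,
              subst S (sym θ≡γ) (subst (λ z → S (map γ z)) (take-++ ns w) s))
        (λ (vs , concat≡ , ds , s) →
           let ns , θ≡γ = γ-covers-θ* vs ds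
               vs≡blocks = trans (sym (blocks-concat k vs)) (cong (blocks k) concat≡)
           in ns , subst (λ z → S (map γ z)) (sym (take-++ ns w)) (subst S θ≡γ s) ,
              from (take-drop-++⇔ Matches ns w)
                (from (Matches⇔Represents ns w) (subst (λ z → Represents z ns) vs≡blocks (ds , θ≡γ))))

  γ-listable⇔θ*-listable : ∀ {k} (S : Vec (C₂) k → Set) →
                           RhoListable γ S ⇔ RhoListable ρ (θ* S)
  γ-listable⇔θ*-listable S = mk⇔ (λ γS → Σ₁⇒Listable (γ-Σ₁⇒θ*-Σ₁ {S = S} (Listable⇒Σ₁ γS)))
                                 (λ θ*S → Σ₁⇒Listable (θ*-Σ₁⇒γ-Σ₁ {S = S} (Listable⇒Σ₁ θ*S)))

  θ*-definable⇒γ-listable : ∀ {k} (S : Vec (C₂) k → Set) →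
                             PEDefinable M₁ (θ* S) → RhoListable γ S
  θ*-definable⇒γ-listable S θ*S-pe = Σ₁⇒Listable (θ*-Σ₁⇒γ-Σ₁ {S = S} (PEDefinable⇒Σ₁ θ*S-pe))

  γ-presentation : IsListablePresentation M₂ γ
  γ-presentation = record
    { surjective   = λ m → let v , d , θvd≡m = surj m ; n , γn≡θvd = γ-covers-θ v d
                            in n , trans γn≡θvd θvd≡m
    ; eq-listable  = θ*-definable⇒γ-listable (EqRel M₂) eq-pe
    ; rel-listable = λ R → θ*-definable⇒γ-listable (Structure.rel M₂ R) (rel-pe R)
    ; fun-listable = λ g → θ*-definable⇒γ-listable (Graph M₂ g) (fun-pe g)
    }

proposition3p11 : (L₁ L₂ : Language) (M₁ : Structure L₁) (M₂ : Structure L₂) →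
                  Structure.Carrier M₂ →
                  (r : ℕ) (Θ : PEInterpretation M₁ M₂ r) →
                  (ρ : ℕ → Structure.Carrier M₁) → IsListablePresentation M₁ ρ →
                  (Σ (ℕ → Vec ℕ r) (λ f → TotalRecursive f × HasImage f (domPre Θ ρ)))
                  × (∀ (f : ℕ → Vec ℕ r) → TotalRecursive f →
                       (img : HasImage f (domPre Θ ρ)) →
                       IsListablePresentation M₂ (gamma Θ ρ f img)
                       × (∀ (k : ℕ) (S : Vec (Structure.Carrier M₂) k → Set) →
                            RhoListable (gamma Θ ρ f img) S
                            ⇔ RhoListable ρ (PEInterpretation.θ* Θ S)))
proposition3p11 L₁ L₂ M₁ M₂ m₂ r Θ ρ presentation =
  enumeration , λ f f-total image → let open Interpretation Θ ρ presentation f f-total image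
                                    in γ-presentation , λ k → γ-listable⇔θ*-listable
  where
    open PEInterpretation Θ
    open ListablePresentation M₁ ρ presentation using (surjective-vec; PEDefinable⇒Σ₁)

    -- The element m₂ of M₂ yields the point of X that a total enumeration needs.
    enumeration : Σ (ℕ → Vec ℕ r) λ f → TotalRecursive f × HasImage f (domPre Θ ρ)
    enumeration with surj m₂
    ... | v , d , _ with surjective-vec v
    ... | b , ρb≡v = enumerate (PEDefinable⇒Σ₁ dom-pe) (subst dom (sym ρb≡v) d)
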